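{- Let $G$ be a partial cube, let $k\ge 3$, and let $F_1,\ldots,F_{k-1}$ be $\Theta$-classes of $G$. Then $\bigcup_{i=1}^{k-1}F_i$ is an edge $k$-general position set of $G$.
   Context: A connected graph $G$ is a partial cube if it is isomorphic to a subgraph of some hypercube $Q_d$ with $d_G(x,y)=d_{Q_d}(x,y)$ for all $x,y\in V(G)$. Edges $xy$ and $uv$ of $G$ are in relation $\Theta$ if $d_G(x,u)+d_G(y,v)\ne d_G(x,v)+d_G(y,u)$; in a partial cube $\Theta$ is an equivalence relation on $E(G)$, and its equivalence classes are the $\Theta$-classes. A geodesic is a shortest path. An edge $k$-general position set of $G$ is a set $S\subseteq E(G)$ with $|S\cap E(P)|\le k-1$ for every geodesic $P$ of $G$. -}

module Defs where

open import Data.Nat using (ℕ; zero; suc; _+_; _≤_)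
open import Data.Fin using (Fin)
open import Data.Vec using (Vec; []; _∷_)
open import Data.Bool using (Bool; true; false)
open import Data.Product using (Σ; ∃; _×_; _,_)
open import Data.Sum using (_⊎_)
open import Relation.Binary.PropositionalEquality using (_≡_; _≢_)
open import Relation.Nullary using (¬_)

record Graph : Set₁ where
  field
    n       : ℕ
    Adj     : Fin n → Fin n → Set
    sym     : ∀ {x y} → Adj x y → Adj y x
    irrefl  : ∀ {x} → ¬ Adj x x
open Graph public

module _ (G : Graph) where

  data Walk : Fin (n G) → Fin (n G) → Set where
    [] : ∀ {x} → Walk x x
    _∷_ : ∀ {x y z} → Adj G x y → Walk y z → Walk x z

  len : ∀ {x y} → Walk x y → ℕ
  len []       = 0
  len (_ ∷ w)  = suc (len w)

  Connected : Set
  Connected = ∀ x y → Walk x y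

  Dist : Fin (n G) → Fin (n G) → ℕ → Set
  Dist x y m = Σ (Walk x y) λ w → len w ≡ m × (∀ (w' : Walk x y) → m ≤ len w')

  Geodesic : ∀ {x y} → Walk x y → Set
  Geodesic {x} {y} w = ∀ (w' : Walk x y) → len w ≤ len w'

  record Edge : Set where
    constructor edge
    field
      u   : Fin (n G)
      v   : Fin (n G)
      adj : Adj G u v

  _≈ₑ_ : Edge → Edge → Set
  e ≈ₑ f = (Edge.u e ≡ Edge.u f × Edge.v e ≡ Edge.v f)
         ⊎ (Edge.u e ≡ Edge.v f × Edge.v e ≡ Edge.u f)

  data _∈W_ (e : Edge) : ∀ {x y} → Walk x y → Set where
    here  : ∀ {x y z} (a : Adj G x y) (w : Walk y z) → e ≈ₑ edge x y a → e ∈W (a ∷ w)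
    there : ∀ {x y z} (a : Adj G x y) {w : Walk y z} → e ∈W w → e ∈W (a ∷ w)

  Θ : Edge → Edge → Set
  Θ (edge x y _) (edge u v _) =
    ∃ λ a → ∃ λ b → ∃ λ c → ∃ λ d →
      Dist x u a × Dist y v b × Dist x v c × Dist y u d × (a + b ≢ c + d)

  IsThetaClass : (Edge → Set) → Set
  IsThetaClass F = Σ Edge λ e → ∀ f → (F f → Θ e f) × (Θ e f → F f)

  -- edge k-general position set: every geodesic contains at most k-1 edges of S,
  -- i.e. no k pairwise distinct edges of S all lie on one geodesic
  EdgeGPSet : ℕ → (Edge → Set) → Set
  EdgeGPSet k S = ∀ {x y} (P : Walk x y) → Geodesic P →
    (es : Fin k → Edge) → (∀ i j → es i ≈ₑ es j → i ≡ j) →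
    (∀ i → S (es i)) → (∀ i → es i ∈W P) → Data.Empty.⊥
    where import Data.Empty

-- Hamming distance (= distance in the hypercube Q_d)
hamming : ∀ {d} → Vec Bool d → Vec Bool d → ℕ
hamming [] [] = 0
hamming (a ∷ as) (b ∷ bs) = hd a b + hamming as bs
  where
    hd : Bool → Bool → ℕ
    hd true  true  = 0
    hd false false = 0
    hd _     _     = 1

PartialCube : Graph → Set
PartialCube G = Connected G ×
  ∃ λ d → Σ (Fin (n G) → Vec Bool d) λ f →
    ∀ x y m → Dist G x y m → hamming (f x) (f y) ≡ m

-- An isometric embedding φ of G into Q_d sends each edge to a cube edge, i.e. each edge of G
-- flips exactly one coordinate, and Θ-related edges flip the same coordinate (for different
-- coordinates the two sums of Hamming distances in the definition of Θ agree). A geodesic of G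
-- has length equal to the Hamming distance of its ends, so it flips no coordinate twice and
-- therefore contains at most one edge of each Θ-class; k of its edges cannot then lie in k − 1
-- classes, by pigeonhole.

module Submission where

open import Defs hiding (sym)
open import Data.Nat using (ℕ; zero; suc; _+_; _≤_; _<_; _≥_; _∸_; z≤n; s≤s)
open import Data.Nat.Properties
  using (≤-refl; ≤-reflexive; ≤-antisym; ≤-pred; +-mono-≤; n<1+n; 1+n≰n; suc-injective; module ≤-Reasoning)
open import Data.Nat.Solver using (module +-*-Solver)
open import Data.Fin using (Fin; zero; suc)
open import Data.Fin.Properties using (pigeonhole; <⇒≢) renaming (_≟_ to _≟ᶠ_)
open import Data.Vec using (Vec; []; _∷_; lookup; updateAt)
open import Data.Vec.Properties using (updateAt-updateAt-local; updateAt-id)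
open import Data.Bool using (Bool; true; false; not)
open import Data.Bool.Properties using (not-involutive)
open import Data.Product using (∃; _,_; proj₁; proj₂)
open import Data.Sum using (inj₁; inj₂)
open import Data.Empty using (⊥-elim)
open import Relation.Nullary using (¬_; yes; no)
open import Relation.Binary.PropositionalEquality
  using (_≡_; _≢_; refl; sym; trans; cong; cong₂; subst; subst₂; module ≡-Reasoning)

open +-*-Solver using (solve; _:+_; _:=_)

bitDist : Bool → Bool → ℕ
bitDist true  true  = 0
bitDist false false = 0
bitDist _     _     = 1

hamming-∷ : ∀ {d} a b (as bs : Vec Bool d) → hamming (a ∷ as) (b ∷ bs) ≡ bitDist a b + hamming as bs
hamming-∷ true  true  _ _ = refl
hamming-∷ true  false _ _ = refl
hamming-∷ false true  _ _ = refl
hamming-∷ false false _ _ = refl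

hamming-self : ∀ {d} (a : Vec Bool d) → hamming a a ≡ 0
hamming-self []           = refl
hamming-self (true  ∷ as) = hamming-self as
hamming-self (false ∷ as) = hamming-self as

hamming≡0⇒≡ : ∀ {d} (a b : Vec Bool d) → hamming a b ≡ 0 → a ≡ b
hamming≡0⇒≡ []           []           _ = refl
hamming≡0⇒≡ (true  ∷ as) (true  ∷ bs) e = cong (true ∷_) (hamming≡0⇒≡ as bs e)
hamming≡0⇒≡ (false ∷ as) (false ∷ bs) e = cong (false ∷_) (hamming≡0⇒≡ as bs e)
hamming≡0⇒≡ (true  ∷ as) (false ∷ bs) ()
hamming≡0⇒≡ (false ∷ as) (true  ∷ bs) ()

bitDist-triangle : ∀ a b c → bitDist a c ≤ bitDist a b + bitDist b c
bitDist-triangle true  true  true  = z≤n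
bitDist-triangle true  true  false = ≤-refl
bitDist-triangle true  false true  = z≤n
bitDist-triangle true  false false = ≤-refl
bitDist-triangle false true  true  = ≤-refl
bitDist-triangle false true  false = z≤n
bitDist-triangle false false true  = ≤-refl
bitDist-triangle false false false = z≤n

+-interchange : ∀ a b c d → (a + b) + (c + d) ≡ (a + c) + (b + d)
+-interchange = solve 4 (λ a b c d → (a :+ b) :+ (c :+ d) := (a :+ c) :+ (b :+ d)) refl

hamming-triangle : ∀ {d} (a b c : Vec Bool d) → hamming a c ≤ hamming a b + hamming b c
hamming-triangle [] [] [] = z≤n
hamming-triangle (p ∷ as) (q ∷ bs) (r ∷ cs) =
  subst₂ _≤_ (sym (hamming-∷ p r as cs))
    (trans (+-interchange (bitDist p q) (bitDist q r) (hamming as bs) (hamming bs cs))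
           (sym (cong₂ _+_ (hamming-∷ p q as bs) (hamming-∷ q r bs cs))))
    (+-mono-≤ (bitDist-triangle p q r) (hamming-triangle as bs cs))

flipAt : ∀ {d} → Fin d → Vec Bool d → Vec Bool d
flipAt i a = updateAt a i not

flipAt-involutive : ∀ {d} (i : Fin d) (a : Vec Bool d) → flipAt i (flipAt i a) ≡ a
flipAt-involutive i a = trans (updateAt-updateAt-local i a (not-involutive (lookup a i))) (updateAt-id i a)

hamming≡1⇒flipAt : ∀ {d} (a b : Vec Bool d) → hamming a b ≡ 1 → ∃ λ i → b ≡ flipAt i a
hamming≡1⇒flipAt []           []           ()
hamming≡1⇒flipAt (true  ∷ as) (true  ∷ bs) e with i , b≡ ← hamming≡1⇒flipAt as bs e = suc i , cong (true ∷_) b≡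
hamming≡1⇒flipAt (false ∷ as) (false ∷ bs) e with i , b≡ ← hamming≡1⇒flipAt as bs e = suc i , cong (false ∷_) b≡
hamming≡1⇒flipAt (true  ∷ as) (false ∷ bs) e = zero , cong (false ∷_) (sym (hamming≡0⇒≡ as bs (suc-injective e)))
hamming≡1⇒flipAt (false ∷ as) (true  ∷ bs) e = zero , cong (true ∷_) (sym (hamming≡0⇒≡ as bs (suc-injective e)))

hamming-flipAt-flipAt : ∀ {d} (i : Fin d) (a b : Vec Bool d) → hamming (flipAt i a) (flipAt i b) ≡ hamming a b
hamming-flipAt-flipAt zero    (true  ∷ as) (true  ∷ bs) = refl
hamming-flipAt-flipAt zero    (true  ∷ as) (false ∷ bs) = refl
hamming-flipAt-flipAt zero    (false ∷ as) (true  ∷ bs) = refl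
hamming-flipAt-flipAt zero    (false ∷ as) (false ∷ bs) = refl
hamming-flipAt-flipAt (suc i) (p ∷ as) (q ∷ bs) = begin
  hamming (p ∷ flipAt i as) (q ∷ flipAt i bs)       ≡⟨ hamming-∷ p q (flipAt i as) (flipAt i bs) ⟩
  bitDist p q + hamming (flipAt i as) (flipAt i bs) ≡⟨ cong (bitDist p q +_) (hamming-flipAt-flipAt i as bs) ⟩
  bitDist p q + hamming as bs                       ≡⟨ hamming-∷ p q as bs ⟨
  hamming (p ∷ as) (q ∷ bs)                         ∎
  where open ≡-Reasoning

hamming-flipAt-exchange : ∀ {d} (i j : Fin d) → i ≢ j → ∀ x u →
  hamming x u + hamming (flipAt i x) (flipAt j u) ≡ hamming x (flipAt j u) + hamming (flipAt i x) u
hamming-flipAt-exchange zero zero i≢j _ _ = ⊥-elim (i≢j refl)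
hamming-flipAt-exchange zero (suc j) _ (p ∷ xs) (q ∷ us) = begin
  hamming (p ∷ xs) (q ∷ us) + hamming (not p ∷ xs) (q ∷ flipAt j us)
    ≡⟨ cong₂ _+_ (hamming-∷ p q xs us) (hamming-∷ (not p) q xs (flipAt j us)) ⟩
  (bitDist p q + hamming xs us) + (bitDist (not p) q + hamming xs (flipAt j us))
    ≡⟨ solve 4 (λ a b c e → (a :+ b) :+ (c :+ e) := (a :+ e) :+ (c :+ b)) refl
         (bitDist p q) (hamming xs us) (bitDist (not p) q) (hamming xs (flipAt j us)) ⟩
  (bitDist p q + hamming xs (flipAt j us)) + (bitDist (not p) q + hamming xs us)
    ≡⟨ sym (cong₂ _+_ (hamming-∷ p q xs (flipAt j us)) (hamming-∷ (not p) q xs us)) ⟩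
  hamming (p ∷ xs) (q ∷ flipAt j us) + hamming (not p ∷ xs) (q ∷ us)
    ∎
  where open ≡-Reasoning
hamming-flipAt-exchange (suc i) zero _ (p ∷ xs) (q ∷ us) = begin
  hamming (p ∷ xs) (q ∷ us) + hamming (p ∷ flipAt i xs) (not q ∷ us)
    ≡⟨ cong₂ _+_ (hamming-∷ p q xs us) (hamming-∷ p (not q) (flipAt i xs) us) ⟩
  (bitDist p q + hamming xs us) + (bitDist p (not q) + hamming (flipAt i xs) us)
    ≡⟨ solve 4 (λ a b c e → (a :+ b) :+ (c :+ e) := (c :+ b) :+ (a :+ e)) refl
         (bitDist p q) (hamming xs us) (bitDist p (not q)) (hamming (flipAt i xs) us) ⟩
  (bitDist p (not q) + hamming xs us) + (bitDist p q + hamming (flipAt i xs) us)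
    ≡⟨ sym (cong₂ _+_ (hamming-∷ p (not q) xs us) (hamming-∷ p q (flipAt i xs) us)) ⟩
  hamming (p ∷ xs) (not q ∷ us) + hamming (p ∷ flipAt i xs) (q ∷ us)
    ∎
  where open ≡-Reasoning
hamming-flipAt-exchange (suc i) (suc j) i≢j (p ∷ xs) (q ∷ us) = begin
  hamming (p ∷ xs) (q ∷ us) + hamming (p ∷ flipAt i xs) (q ∷ flipAt j us)
    ≡⟨ cong₂ _+_ (hamming-∷ p q xs us) (hamming-∷ p q (flipAt i xs) (flipAt j us)) ⟩
  (b + hamming xs us) + (b + hamming (flipAt i xs) (flipAt j us))
    ≡⟨ +-interchange b (hamming xs us) b _ ⟩
  (b + b) + (hamming xs us + hamming (flipAt i xs) (flipAt j us))
    ≡⟨ cong ((b + b) +_) (hamming-flipAt-exchange i j (λ i≡j → i≢j (cong suc i≡j)) xs us) ⟩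
  (b + b) + (hamming xs (flipAt j us) + hamming (flipAt i xs) us)
    ≡⟨ sym (+-interchange b (hamming xs (flipAt j us)) b _) ⟩
  (b + hamming xs (flipAt j us)) + (b + hamming (flipAt i xs) us)
    ≡⟨ sym (cong₂ _+_ (hamming-∷ p q xs (flipAt j us)) (hamming-∷ p q (flipAt i xs) us)) ⟩
  hamming (p ∷ xs) (q ∷ flipAt j us) + hamming (p ∷ flipAt i xs) (q ∷ us)
    ∎
  where open ≡-Reasoning
        b = bitDist p q

module _ (G : Graph) where

  ≈ₑ-sym : ∀ {e f} → _≈ₑ_ G e f → _≈ₑ_ G f e
  ≈ₑ-sym (inj₁ (p , q)) = inj₁ (sym p , sym q)
  ≈ₑ-sym (inj₂ (p , q)) = inj₂ (sym q , sym p)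

  ≈ₑ-trans : ∀ {e f g} → _≈ₑ_ G e f → _≈ₑ_ G f g → _≈ₑ_ G e g
  ≈ₑ-trans (inj₁ (p , q)) (inj₁ (r , s)) = inj₁ (trans p r , trans q s)
  ≈ₑ-trans (inj₁ (p , q)) (inj₂ (r , s)) = inj₂ (trans p r , trans q s)
  ≈ₑ-trans (inj₂ (p , q)) (inj₁ (r , s)) = inj₂ (trans p s , trans q r)
  ≈ₑ-trans (inj₂ (p , q)) (inj₂ (r , s)) = inj₁ (trans p s , trans q r)

  adjacent⇒dist1 : ∀ {x y} → Adj G x y → Dist G x y 1
  adjacent⇒dist1 {x} {y} a = a ∷ [] , refl , nonempty
    where
    nonempty : (w : Walk G x y) → 1 ≤ len G w
    nonempty []      = ⊥-elim (irrefl G a)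
    nonempty (_ ∷ _) = s≤s z≤n

module IsometricEmbedding (G : Graph) {d : ℕ} (φ : Fin (n G) → Vec Bool d)
         (isometric : ∀ x y m → Dist G x y m → hamming (φ x) (φ y) ≡ m) where

  hamming-adjacent : ∀ {x y} → Adj G x y → hamming (φ x) (φ y) ≡ 1
  hamming-adjacent {x} {y} a = isometric x y 1 (adjacent⇒dist1 G a)

  hamming≤len : ∀ {x y} (w : Walk G x y) → hamming (φ x) (φ y) ≤ len G w
  hamming≤len {x} [] = ≤-reflexive (hamming-self (φ x))
  hamming≤len {x} {z} (_∷_ {y = y} a w) = begin
    hamming (φ x) (φ z)                       ≤⟨ hamming-triangle (φ x) (φ y) (φ z) ⟩
    hamming (φ x) (φ y) + hamming (φ y) (φ z) ≡⟨ cong (_+ hamming (φ y) (φ z)) (hamming-adjacent a) ⟩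
    suc (hamming (φ y) (φ z))                 ≤⟨ s≤s (hamming≤len w) ⟩
    suc (len G w)                             ∎
    where open ≤-Reasoning

  Tight : ∀ {x y} → Walk G x y → Set
  Tight {x} {y} w = hamming (φ x) (φ y) ≡ len G w

  geodesic⇒tight : ∀ {x y} (P : Walk G x y) → Geodesic G P → Tight P
  geodesic⇒tight {x} {y} P geodesic = isometric x y (len G P) (P , refl , geodesic)

  tight-tail : ∀ {x y z} (a : Adj G x y) (w : Walk G y z) → Tight (a ∷ w) → Tight w
  tight-tail {x} {y} {z} a w tight = ≤-antisym (hamming≤len w) (≤-pred (begin
    suc (len G w)                             ≡⟨ tight ⟨
    hamming (φ x) (φ z)                       ≤⟨ hamming-triangle (φ x) (φ y) (φ z) ⟩
    hamming (φ x) (φ y) + hamming (φ y) (φ z) ≡⟨ cong (_+ hamming (φ y) (φ z)) (hamming-adjacent a) ⟩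
    suc (hamming (φ y) (φ z))                 ∎))
    where open ≤-Reasoning

  Flips : Edge G → Fin d → Set
  Flips (edge x y _) i = φ y ≡ flipAt i (φ x)

  flippedCoordinate : (e : Edge G) → ∃ (Flips e)
  flippedCoordinate (edge x y a) = hamming≡1⇒flipAt (φ x) (φ y) (hamming-adjacent a)

  Flips-≈ₑ : ∀ {e x y i} (a : Adj G x y) → _≈ₑ_ G e (edge x y a) → Flips e i → φ y ≡ flipAt i (φ x)
  Flips-≈ₑ _ (inj₁ (refl , refl)) flips = flips
  Flips-≈ₑ {edge u _ _} {i = i} _ (inj₂ (refl , refl)) flips =
    trans (sym (flipAt-involutive i (φ u))) (cong (flipAt i) (sym flips))

  Θ⇒flips-same : ∀ e f {i j} → Θ G e f → Flips e i → Flips f j → i ≡ j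
  Θ⇒flips-same (edge x y _) (edge u v _) {i} {j} (a , b , c , c′ , xu , yv , xv , yu , a+b≢c+c′) flips-e flips-f
    with i ≟ᶠ j
  ... | yes i≡j = i≡j
  ... | no  i≢j = ⊥-elim (a+b≢c+c′ (begin
    a + b
      ≡⟨ cong₂ _+_ (isometric _ _ _ xu) (isometric _ _ _ yv) ⟨
    hamming (φ x) (φ u) + hamming (φ y) (φ v)
      ≡⟨ cong₂ (λ p q → hamming (φ x) (φ u) + hamming p q) flips-e flips-f ⟩
    hamming (φ x) (φ u) + hamming (flipAt i (φ x)) (flipAt j (φ u))
      ≡⟨ hamming-flipAt-exchange i j i≢j (φ x) (φ u) ⟩
    hamming (φ x) (flipAt j (φ u)) + hamming (flipAt i (φ x)) (φ u)
      ≡⟨ cong₂ (λ p q → hamming (φ x) p + hamming q (φ u)) flips-f flips-e ⟨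
    hamming (φ x) (φ v) + hamming (φ y) (φ u)
      ≡⟨ cong₂ _+_ (isometric _ _ _ xv) (isometric _ _ _ yu) ⟩
    c + c′
      ∎))
    where open ≡-Reasoning

  classCoordinate : ∀ {F} → IsThetaClass G F → Fin d
  classCoordinate (r , _) = proj₁ (flippedCoordinate r)

  ThetaClass-flips : ∀ {F} (class : IsThetaClass G F) {e} → F e → Flips e (classCoordinate class)
  ThetaClass-flips (r , members) {e} e∈F with i , flips-e ← flippedCoordinate e =
    subst (Flips e) (sym (Θ⇒flips-same r e (proj₁ (members e) e∈F) (proj₂ (flippedCoordinate r)) flips-e)) flips-e

  ∈W⇒hamming-flipAt<len : ∀ {y z e i} (w : Walk G y z) → _∈W_ G e w → Flips e i →
                          hamming (flipAt i (φ y)) (φ z) < len G w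
  ∈W⇒hamming-flipAt<len {z = z} {e} (a ∷ w) (here _ _ e≈a) flips =
    s≤s (subst (λ p → hamming p (φ z) ≤ len G w) (Flips-≈ₑ {e} a e≈a flips) (hamming≤len w))
  ∈W⇒hamming-flipAt<len {y} {z} {i = i} (_∷_ {y = t} a w) (there _ e∈w) flips = s≤s (begin
    hamming (flipAt i (φ y)) (φ z)
      ≤⟨ hamming-triangle (flipAt i (φ y)) (flipAt i (φ t)) (φ z) ⟩
    hamming (flipAt i (φ y)) (flipAt i (φ t)) + hamming (flipAt i (φ t)) (φ z)
      ≡⟨ cong (_+ hamming (flipAt i (φ t)) (φ z)) (trans (hamming-flipAt-flipAt i (φ y) (φ t)) (hamming-adjacent a)) ⟩
    suc (hamming (flipAt i (φ t)) (φ z))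
      ≤⟨ ∈W⇒hamming-flipAt<len w e∈w flips ⟩
    len G w
      ∎)
    where open ≤-Reasoning

  tight⇒first-flip-not-repeated : ∀ {x y z f i} (a : Adj G x y) (w : Walk G y z) → Tight (a ∷ w) →
                            φ y ≡ flipAt i (φ x) → _∈W_ G f w → ¬ Flips f i
  tight⇒first-flip-not-repeated {x} {y} {z} {i = i} a w tight flips-a f∈w flips-f = 1+n≰n (begin
    suc (len G w)                             ≡⟨ tight ⟨
    hamming (φ x) (φ z)                       ≡⟨ cong (λ p → hamming p (φ z)) (flipAt-involutive i (φ x)) ⟨
    hamming (flipAt i (flipAt i (φ x))) (φ z) ≡⟨ cong (λ p → hamming (flipAt i p) (φ z)) flips-a ⟨
    hamming (flipAt i (φ y)) (φ z)            <⟨ ∈W⇒hamming-flipAt<len w f∈w flips-f ⟩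
    len G w                                   ∎)
    where open ≤-Reasoning

  tight⇒flips-unique : ∀ {x y e f i} (P : Walk G x y) → Tight P →
                       _∈W_ G e P → _∈W_ G f P → Flips e i → Flips f i → _≈ₑ_ G e f
  tight⇒flips-unique {e = e} {f} (a ∷ w) _ (here _ _ e≈a) (here _ _ f≈a) _ _ =
    ≈ₑ-trans G {e} {edge _ _ a} {f} e≈a (≈ₑ-sym G {f} {edge _ _ a} f≈a)
  tight⇒flips-unique {e = e} (a ∷ w) tight (here _ _ e≈a) (there _ f∈w) flips-e flips-f =
    ⊥-elim (tight⇒first-flip-not-repeated a w tight (Flips-≈ₑ {e} a e≈a flips-e) f∈w flips-f)
  tight⇒flips-unique {f = f} (a ∷ w) tight (there _ e∈w) (here _ _ f≈a) flips-e flips-f =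
    ⊥-elim (tight⇒first-flip-not-repeated a w tight (Flips-≈ₑ {f} a f≈a flips-f) e∈w flips-e)
  tight⇒flips-unique (a ∷ w) tight (there _ e∈w) (there _ f∈w) flips-e flips-f =
    tight⇒flips-unique w (tight-tail a w tight) e∈w f∈w flips-e flips-f

  geodesic-meets-ThetaClass-once : ∀ {F x y e f} (P : Walk G x y) → Geodesic G P → IsThetaClass G F →
                                   F e → F f → _∈W_ G e P → _∈W_ G f P → _≈ₑ_ G e f
  geodesic-meets-ThetaClass-once P geodesic class e∈F f∈F e∈P f∈P =
    tight⇒flips-unique P (geodesic⇒tight P geodesic) e∈P f∈P (ThetaClass-flips class e∈F) (ThetaClass-flips class f∈F)

lemma4p1 : (G : Graph) → PartialCube G → (k : ℕ) → k ≥ 3 →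
    (F : Fin (k ∸ 1) → Edge G → Set) → (∀ i → IsThetaClass G (F i)) →
    EdgeGPSet G k (λ e → ∃ λ i → F i e)
-- k ≥ 3 only serves to rule out k = 0; that clause is discharged by the coverage checker.
lemma4p1 G (_ , _ , φ , isometric) (suc k) _ F classes P geodesic es distinct inS onP
  with i , j , i<j , same ← pigeonhole (n<1+n k) (λ t → proj₁ (inS t)) =
  <⇒≢ i<j (distinct i j (geodesic-meets-ThetaClass-once P geodesic (classes (proj₁ (inS i)))
    (proj₂ (inS i)) (subst (λ c → F c (es j)) (sym same) (proj₂ (inS j))) (onP i) (onP j)))
  where open IsometricEmbedding G φ isometric
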